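{- Let $s,t$ be non-negative integers and let $G_1,G_2,G_3$ be graphs. If $G_2$ is an $s$-perturbation of $G_1$ and $G_3$ is a $t$-perturbation of $G_2$, then $G_3$ is an $(s+t)$-perturbation of $G_1$.
   Context: Local complementation at a vertex $v$ replaces the induced subgraph on $N_G(v)$ by its complement; a vertex-minor of $G$ is an induced subgraph of a graph obtained from $G$ by a sequence of local complementations. For a non-negative integer $t$, $G_1$ is a $t$-perturbation of $G_2$ if $V(G_1)=V(G_2)$ and there exists a graph on $|V(G_1)|+t$ vertices containing both $G_1$ and $G_2$ as vertex-minors. -}

module Defs where

open import Data.Nat using (ℕ; _+_)
open import Data.Fin using (Fin; _≟_)
open import Data.Bool using (Bool; true; false; _∧_; not; _xor_)
open import Data.Bool.Properties using (∧-comm)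
open import Relation.Nullary using (yes; no)
open import Relation.Nullary.Decidable using (⌊_⌋)
open import Relation.Binary.PropositionalEquality using (_≡_; refl; sym; cong; cong₂)
open import Function.Definitions using (Injective)
open import Data.Product using (Σ; _×_; ∃)

record Graph (n : ℕ) : Set where
  field
    adj     : Fin n → Fin n → Bool
    adj-sym : ∀ x y → adj x y ≡ adj y x
    adj-irr : ∀ x → adj x x ≡ false
open Graph public

distinct : ∀ {n} → Fin n → Fin n → Bool
distinct x y = not ⌊ x ≟ y ⌋

private
  distinct-sym : ∀ {n} (x y : Fin n) → distinct x y ≡ distinct y x
  distinct-sym x y with x ≟ y | y ≟ x
  ... | yes _ | yes _ = refl
  ... | no _  | no _  = refl
  ... | yes p | no q with q (sym p)
  ... | ()
  distinct-sym x y | no p | yes q with p (sym q)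
  ... | ()

  distinct-irr : ∀ {n} (x : Fin n) → distinct x x ≡ false
  distinct-irr x with x ≟ x
  ... | yes _ = refl
  ... | no p with p refl
  ... | ()

  xor-false : ∀ b → b xor false ≡ b
  xor-false true = refl
  xor-false false = refl

  ∧-false : ∀ b → b ∧ false ≡ false
  ∧-false true = refl
  ∧-false false = refl

-- Local complementation at v: complement the subgraph induced on N(v).
-- Edge xy is toggled iff x ≠ y and both x,y are neighbours of v.
localComp : ∀ {n} → Graph n → Fin n → Graph n
localComp {n} G v = record
  { adj     = a
  ; adj-sym = λ x y → cong₂ _xor_ (adj-sym G x y)
                 (cong₂ _∧_ (∧-comm (adj G v x) (adj G v y)) (distinct-sym x y))
  ; adj-irr = λ x → irr x
  }
  where
  a : Fin n → Fin n → Bool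
  a x y = adj G x y xor ((adj G v x ∧ adj G v y) ∧ distinct x y)
  irr : ∀ x → a x x ≡ false
  irr x rewrite distinct-irr x | ∧-false (adj G v x ∧ adj G v x)
              | xor-false (adj G x x) = adj-irr G x

data LocallyEquivalent {n : ℕ} : Graph n → Graph n → Set where
  done : ∀ {G} → LocallyEquivalent G G
  step : ∀ {G H} (v : Fin n) → LocallyEquivalent (localComp G v) H → LocallyEquivalent G H

-- G (on vertex set Fin m) is a vertex-minor of H (on vertex set Fin k), where the
-- vertices of G are identified with vertices of H via the injection f:
-- G is the subgraph induced on f(Fin m) of a graph locally equivalent to H.
IsVertexMinorVia : ∀ {m k} → Graph m → Graph k → (Fin m → Fin k) → Set
IsVertexMinorVia {m} {k} G H f =
  Σ (Graph k) λ H' → LocallyEquivalent H H' × (∀ x y → adj G x y ≡ adj H' (f x) (f y))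

-- G₁ is a t-perturbation of G₂ (both on the same vertex set Fin n): some graph on
-- n + t vertices contains both G₁ and G₂ as vertex-minors (with the common vertex
-- set Fin n embedded by the same injection).
IsPerturbation : ∀ {n} → ℕ → Graph n → Graph n → Set
IsPerturbation {n} t G₁ G₂ =
  Σ (Graph (n + t)) λ H → Σ (Fin n → Fin (n + t)) λ f →
    Injective _≡_ _≡_ f × IsVertexMinorVia G₁ H f × IsVertexMinorVia G₂ H f

{-# OPTIONS --safe #-}
-- Let H₁ witness that G₂ is an s-perturbation of G₁, and H₂ that G₃ is a
-- t-perturbation of G₂. Both H₁ and H₂ are locally equivalent to graphs A and D
-- inducing G₂ on the n labelled vertices. Glue A and D along these n vertices,
-- with no edges between their private parts, to get a graph K on n + s + t
-- vertices. Local complementation commutes with taking induced subgraphs and is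
-- an involution, so the local equivalences H₁ ~ A and H₂ ~ D lift to K: H₁ and
-- H₂, and hence G₁ and G₃, are vertex-minors of K.
module Submission where

open import Defs
open import Data.Nat using (ℕ; zero; suc; _+_)
open import Data.Fin using (Fin; zero; suc; punchIn; punchOut; splitAt; join; _≟_)
open import Data.Fin.Properties
  using (punchOut-cong; punchOut-injective; punchIn-punchOut; splitAt-join; suc-injective)
open import Data.Bool using (Bool; false; _∧_; _xor_)
open import Data.Bool.Properties using (xor-assoc; xor-same; xor-identityʳ)
open import Data.Sum using (_⊎_; inj₁; inj₂; map₁; map₂)
open import Data.Sum.Properties using (inj₁-injective; inj₂-injective)
open import Data.Product using (_,_)
open import Data.Empty using (⊥-elim)
open import Function using (id; _∘_)
open import Function.Definitions using (Injective)
open import Relation.Nullary using (yes; no)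
open import Relation.Binary.PropositionalEquality

private
  variable
    k m n s t : ℕ

IsInducedSubgraphVia : Graph m → Graph k → (Fin m → Fin k) → Set
IsInducedSubgraphVia G H f = ∀ x y → adj G x y ≡ adj H (f x) (f y)

distinct-injective : {f : Fin m → Fin k} → Injective _≡_ _≡_ f →
  ∀ x y → distinct x y ≡ distinct (f x) (f y)
distinct-injective {f = f} f-inj x y with x ≟ y | f x ≟ f y
... | yes _   | yes _    = refl
... | no _    | no _     = refl
... | yes x≡y | no fx≢fy = ⊥-elim (fx≢fy (cong f x≡y))
... | no x≢y  | yes fx≡fy = ⊥-elim (x≢y (f-inj fx≡fy))

inducedSubgraph-localComp : {G : Graph m} {H : Graph k} {f : Fin m → Fin k} →
  Injective _≡_ _≡_ f → IsInducedSubgraphVia G H f →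
  ∀ v → IsInducedSubgraphVia (localComp G v) (localComp H (f v)) f
inducedSubgraph-localComp f-inj G⊴H v x y =
  cong₂ _xor_ (G⊴H x y)
    (cong₂ _∧_ (cong₂ _∧_ (G⊴H v x) (G⊴H v y)) (distinct-injective f-inj x y))

localComp-involutive : (G : Graph n) (v : Fin n) →
  IsInducedSubgraphVia G (localComp (localComp G v) v) id
localComp-involutive G v x y
  rewrite adj-irr G v | xor-identityʳ (adj G v x) | xor-identityʳ (adj G v y) =
  sym (begin
    (adj G x y xor c) xor c  ≡⟨ xor-assoc (adj G x y) c c ⟩
    adj G x y xor (c xor c)  ≡⟨ cong (adj G x y xor_) (xor-same c) ⟩
    adj G x y xor false      ≡⟨ xor-identityʳ (adj G x y) ⟩
    adj G x y                ∎)
  where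
  open ≡-Reasoning
  c : Bool
  c = (adj G v x ∧ adj G v y) ∧ distinct x y

locallyEquivalent-trans : {G H L : Graph n} →
  LocallyEquivalent G H → LocallyEquivalent H L → LocallyEquivalent G L
locallyEquivalent-trans done        q = q
locallyEquivalent-trans (step v p) q = step v (locallyEquivalent-trans p q)

liftLocalEquivalence : {G G′ : Graph m} {H : Graph k} {f : Fin m → Fin k} →
  Injective _≡_ _≡_ f → IsInducedSubgraphVia G H f →
  LocallyEquivalent G G′ → IsVertexMinorVia G′ H f
liftLocalEquivalence {H = H} f-inj G⊴H done = H , done , G⊴H
liftLocalEquivalence {G = G} {H = H} {f = f} f-inj G⊴H (step v p)
  with liftLocalEquivalence f-inj (inducedSubgraph-localComp {G = G} {H = H} f-inj G⊴H v) p
... | H′ , H*v~H′ , G′⊴H′ = H′ , step (f v) H*v~H′ , G′⊴H′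

liftLocalEquivalence⁻¹ : {G G′ : Graph m} {H : Graph k} {f : Fin m → Fin k} →
  Injective _≡_ _≡_ f → IsInducedSubgraphVia G′ H f →
  LocallyEquivalent G G′ → IsVertexMinorVia G H f
liftLocalEquivalence⁻¹ {H = H} f-inj G′⊴H done = H , done , G′⊴H
liftLocalEquivalence⁻¹ {G = G} {f = f} f-inj G′⊴H (step v p)
  with liftLocalEquivalence⁻¹ f-inj G′⊴H p
... | H′ , H~H′ , G*v⊴H′ =
  localComp H′ (f v) ,
  locallyEquivalent-trans H~H′ (step (f v) done) ,
  λ x y → trans (localComp-involutive G v x y)
                (inducedSubgraph-localComp {G = localComp G v} {H = H′} f-inj G*v⊴H′ v x y)

vertexMinor-trans : {G : Graph m} {H : Graph n} {K : Graph k}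
  {f : Fin m → Fin n} {g : Fin n → Fin k} → Injective _≡_ _≡_ g →
  IsVertexMinorVia G H f → IsVertexMinorVia H K g → IsVertexMinorVia G K (g ∘ f)
vertexMinor-trans g-inj (H′ , H~H′ , G⊴H′) (K′ , K~K′ , H⊴K′)
  with liftLocalEquivalence g-inj H⊴K′ H~H′
... | K″ , K′~K″ , H′⊴K″ =
  K″ , locallyEquivalent-trans K~K′ K′~K″ , λ x y → trans (G⊴H′ x y) (H′⊴K″ _ _)

vertexMinor-cong : {G : Graph m} {H : Graph k} {f g : Fin m → Fin k} →
  (∀ x → f x ≡ g x) → IsVertexMinorVia G H f → IsVertexMinorVia G H g
vertexMinor-cong f≗g (H′ , H~H′ , G⊴H′) =
  H′ , H~H′ , λ x y → trans (G⊴H′ x y) (cong₂ (adj H′) (f≗g x) (f≗g y))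

record Splitting {n t : ℕ} (f : Fin n → Fin (n + t)) : Set where
  field
    split         : Fin (n + t) → Fin n ⊎ Fin t
    unsplit       : Fin n ⊎ Fin t → Fin (n + t)
    unsplit-split : ∀ y → unsplit (split y) ≡ y
    split-f       : ∀ x → split (f x) ≡ inj₁ x

  split-injective : Injective _≡_ _≡_ split
  split-injective {y} {y′} eq =
    trans (sym (unsplit-split y)) (trans (cong unsplit eq) (unsplit-split y′))

  unsplit-inj₁ : ∀ x → unsplit (inj₁ x) ≡ f x
  unsplit-inj₁ x = trans (cong unsplit (sym (split-f x))) (unsplit-split (f x))

open Splitting

-- Remove f zero by punchOut and recurse on the remaining n injective values.
splitting : {f : Fin n → Fin (n + t)} → Injective _≡_ _≡_ f → Splitting f
splitting {zero} _ = record
  { split = inj₂ ; unsplit = λ { (inj₂ j) → j } ; unsplit-split = λ _ → refl ; split-f = λ () }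
splitting {suc n} {t} {f} f-inj = record
  { split = split′ ; unsplit = unsplit′ ; unsplit-split = unsplit-split′ ; split-f = split-f′ }
  where
  f₀≢f-suc : ∀ x → f zero ≢ f (suc x)
  f₀≢f-suc x eq with f-inj eq
  ... | ()

  f⁻ : Fin n → Fin (n + t)
  f⁻ x = punchOut (f₀≢f-suc x)

  S : Splitting f⁻
  S = splitting λ {x} {y} eq →
    suc-injective (f-inj (punchOut-injective (f₀≢f-suc x) (f₀≢f-suc y) eq))

  split′ : Fin (suc n + t) → Fin (suc n) ⊎ Fin t
  split′ y with f zero ≟ y
  ... | yes _    = inj₁ zero
  ... | no f₀≢y = map₁ suc (split S (punchOut f₀≢y))

  unsplit′ : Fin (suc n) ⊎ Fin t → Fin (suc n + t)
  unsplit′ (inj₁ zero)    = f zero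
  unsplit′ (inj₁ (suc x)) = punchIn (f zero) (unsplit S (inj₁ x))
  unsplit′ (inj₂ j)       = punchIn (f zero) (unsplit S (inj₂ j))

  unsplit′-suc : ∀ e → unsplit′ (map₁ suc e) ≡ punchIn (f zero) (unsplit S e)
  unsplit′-suc (inj₁ _) = refl
  unsplit′-suc (inj₂ _) = refl

  unsplit-split′ : ∀ y → unsplit′ (split′ y) ≡ y
  unsplit-split′ y with f zero ≟ y
  ... | yes f₀≡y = f₀≡y
  ... | no f₀≢y = begin
    unsplit′ (map₁ suc (split S (punchOut f₀≢y)))          ≡⟨ unsplit′-suc _ ⟩
    punchIn (f zero) (unsplit S (split S (punchOut f₀≢y))) ≡⟨ cong (punchIn (f zero)) (unsplit-split S _) ⟩
    punchIn (f zero) (punchOut f₀≢y)                       ≡⟨ punchIn-punchOut f₀≢y ⟩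
    y                                                      ∎
    where open ≡-Reasoning

  split-f′ : ∀ x → split′ (f x) ≡ inj₁ x
  split-f′ zero with f zero ≟ f zero
  ... | yes _   = refl
  ... | no f₀≢f₀ = ⊥-elim (f₀≢f₀ refl)
  split-f′ (suc x) with f zero ≟ f (suc x)
  ... | yes f₀≡fx = ⊥-elim (f₀≢f-suc x f₀≡fx)
  ... | no _      =
    cong (map₁ suc) (trans (cong (split S) (punchOut-cong (f zero) refl)) (split-f S x))

record Amalgam (A : Graph (n + s)) (D : Graph (n + t))
               (f : Fin n → Fin (n + s)) (g : Fin n → Fin (n + t)) : Set where
  field
    graph       : Graph (n + (s + t))
    φ           : Fin (n + s) → Fin (n + (s + t))
    ψ           : Fin (n + t) → Fin (n + (s + t))
    φ-injective : Injective _≡_ _≡_ φ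
    ψ-injective : Injective _≡_ _≡_ ψ
    A-induced   : IsInducedSubgraphVia A graph φ
    D-induced   : IsInducedSubgraphVia D graph ψ
    φf≗ψg       : ∀ x → φ (f x) ≡ ψ (g x)

splitAt₃ : ∀ n s {t} → Fin (n + (s + t)) → Fin n ⊎ (Fin s ⊎ Fin t)
splitAt₃ n s u = map₂ (splitAt s) (splitAt n u)

join₃ : ∀ n s t → Fin n ⊎ (Fin s ⊎ Fin t) → Fin (n + (s + t))
join₃ n s t e = join n (s + t) (map₂ (join s t) e)

splitAt₃-join₃ : ∀ n s t e → splitAt₃ n s (join₃ n s t e) ≡ e
splitAt₃-join₃ n s t (inj₁ x) rewrite splitAt-join n (s + t) (inj₁ x) = refl
splitAt₃-join₃ n s t (inj₂ y) rewrite splitAt-join n (s + t) (inj₂ (join s t y)) =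
  cong inj₂ (splitAt-join s t y)

join₃-injective : ∀ n s t → Injective _≡_ _≡_ (join₃ n s t)
join₃-injective n s t {e} {e′} eq =
  trans (sym (splitAt₃-join₃ n s t e)) (trans (cong (splitAt₃ n s) eq) (splitAt₃-join₃ n s t e′))

-- The glued graph lives on Fin n ⊎ (Fin s ⊎ Fin t): the n shared vertices, the rest
-- of A, the rest of D. Shared–shared edges are read off A, and there are no edges
-- between the two rests.
module Gluing {n s t : ℕ} {f : Fin n → Fin (n + s)} {g : Fin n → Fin (n + t)}
  (A : Graph (n + s)) (D : Graph (n + t)) (F : Splitting f) (S : Splitting g) where

  adjA : Fin n ⊎ Fin s → Fin n ⊎ Fin s → Bool
  adjA p q = adj A (unsplit F p) (unsplit F q)

  adjD : Fin n ⊎ Fin t → Fin n ⊎ Fin t → Bool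
  adjD p q = adj D (unsplit S p) (unsplit S q)

  adjE : Fin n ⊎ (Fin s ⊎ Fin t) → Fin n ⊎ (Fin s ⊎ Fin t) → Bool
  adjE (inj₁ x)        (inj₁ y)        = adjA (inj₁ x) (inj₁ y)
  adjE (inj₁ x)        (inj₂ (inj₁ j)) = adjA (inj₁ x) (inj₂ j)
  adjE (inj₁ x)        (inj₂ (inj₂ j)) = adjD (inj₁ x) (inj₂ j)
  adjE (inj₂ (inj₁ i)) (inj₁ y)        = adjA (inj₂ i) (inj₁ y)
  adjE (inj₂ (inj₁ i)) (inj₂ (inj₁ j)) = adjA (inj₂ i) (inj₂ j)
  adjE (inj₂ (inj₁ _)) (inj₂ (inj₂ _)) = false
  adjE (inj₂ (inj₂ i)) (inj₁ y)        = adjD (inj₂ i) (inj₁ y)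
  adjE (inj₂ (inj₂ _)) (inj₂ (inj₁ _)) = false
  adjE (inj₂ (inj₂ i)) (inj₂ (inj₂ j)) = adjD (inj₂ i) (inj₂ j)

  adjE-sym : ∀ e e′ → adjE e e′ ≡ adjE e′ e
  adjE-sym (inj₁ _)        (inj₁ _)        = adj-sym A _ _
  adjE-sym (inj₁ _)        (inj₂ (inj₁ _)) = adj-sym A _ _
  adjE-sym (inj₁ _)        (inj₂ (inj₂ _)) = adj-sym D _ _
  adjE-sym (inj₂ (inj₁ _)) (inj₁ _)        = adj-sym A _ _
  adjE-sym (inj₂ (inj₁ _)) (inj₂ (inj₁ _)) = adj-sym A _ _
  adjE-sym (inj₂ (inj₁ _)) (inj₂ (inj₂ _)) = refl
  adjE-sym (inj₂ (inj₂ _)) (inj₁ _)        = adj-sym D _ _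
  adjE-sym (inj₂ (inj₂ _)) (inj₂ (inj₁ _)) = refl
  adjE-sym (inj₂ (inj₂ _)) (inj₂ (inj₂ _)) = adj-sym D _ _

  adjE-irr : ∀ e → adjE e e ≡ false
  adjE-irr (inj₁ _)        = adj-irr A _
  adjE-irr (inj₂ (inj₁ _)) = adj-irr A _
  adjE-irr (inj₂ (inj₂ _)) = adj-irr D _

  glued : Graph (n + (s + t))
  glued = record
    { adj     = λ u w → adjE (splitAt₃ n s u) (splitAt₃ n s w)
    ; adj-sym = λ u w → adjE-sym (splitAt₃ n s u) (splitAt₃ n s w)
    ; adj-irr = λ u → adjE-irr (splitAt₃ n s u)
    }

  glued-join₃ : ∀ e e′ → adj glued (join₃ n s t e) (join₃ n s t e′) ≡ adjE e e′
  glued-join₃ e e′ = cong₂ adjE (splitAt₃-join₃ n s t e) (splitAt₃-join₃ n s t e′)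

  ιA : Fin n ⊎ Fin s → Fin n ⊎ (Fin s ⊎ Fin t)
  ιA = map₂ inj₁

  ιD : Fin n ⊎ Fin t → Fin n ⊎ (Fin s ⊎ Fin t)
  ιD = map₂ inj₂

  ιA-injective : Injective _≡_ _≡_ ιA
  ιA-injective {inj₁ _} {inj₁ _} eq = cong inj₁ (inj₁-injective eq)
  ιA-injective {inj₂ _} {inj₂ _} eq = cong inj₂ (inj₁-injective (inj₂-injective eq))

  ιD-injective : Injective _≡_ _≡_ ιD
  ιD-injective {inj₁ _} {inj₁ _} eq = cong inj₁ (inj₁-injective eq)
  ιD-injective {inj₂ _} {inj₂ _} eq = cong inj₂ (inj₂-injective (inj₂-injective eq))

  adjE-ιA : ∀ p q → adjE (ιA p) (ιA q) ≡ adjA p q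
  adjE-ιA (inj₁ _) (inj₁ _) = refl
  adjE-ιA (inj₁ _) (inj₂ _) = refl
  adjE-ιA (inj₂ _) (inj₁ _) = refl
  adjE-ιA (inj₂ _) (inj₂ _) = refl

  adjE-ιD : (∀ x y → adj A (f x) (f y) ≡ adj D (g x) (g y)) →
    ∀ p q → adjE (ιD p) (ιD q) ≡ adjD p q
  adjE-ιD A≡D (inj₁ x) (inj₁ y) = begin
    adj A (unsplit F (inj₁ x)) (unsplit F (inj₁ y)) ≡⟨ cong₂ (adj A) (unsplit-inj₁ F x) (unsplit-inj₁ F y) ⟩
    adj A (f x) (f y)                               ≡⟨ A≡D x y ⟩
    adj D (g x) (g y)                               ≡⟨ sym (cong₂ (adj D) (unsplit-inj₁ S x) (unsplit-inj₁ S y)) ⟩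
    adj D (unsplit S (inj₁ x)) (unsplit S (inj₁ y)) ∎
    where open ≡-Reasoning
  adjE-ιD _ (inj₁ _) (inj₂ _) = refl
  adjE-ιD _ (inj₂ _) (inj₁ _) = refl
  adjE-ιD _ (inj₂ _) (inj₂ _) = refl

amalgamate : {G : Graph n} {A : Graph (n + s)} {D : Graph (n + t)}
  {f : Fin n → Fin (n + s)} {g : Fin n → Fin (n + t)} →
  Injective _≡_ _≡_ f → Injective _≡_ _≡_ g →
  IsInducedSubgraphVia G A f → IsInducedSubgraphVia G D g → Amalgam A D f g
amalgamate {n} {s} {t} {A = A} {D} {f} {g} f-inj g-inj G⊴A G⊴D = record
  { graph = glued ; φ = φ ; ψ = ψ ; φ-injective = φ-injective ; ψ-injective = ψ-injective
  ; A-induced = A-induced ; D-induced = D-induced ; φf≗ψg = φf≗ψg }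
  where
  F = splitting f-inj
  S = splitting g-inj
  open Gluing A D F S

  A≡D : ∀ x y → adj A (f x) (f y) ≡ adj D (g x) (g y)
  A≡D x y = trans (sym (G⊴A x y)) (G⊴D x y)

  φ : Fin (n + s) → Fin (n + (s + t))
  φ = join₃ n s t ∘ ιA ∘ split F

  ψ : Fin (n + t) → Fin (n + (s + t))
  ψ = join₃ n s t ∘ ιD ∘ split S

  φ-injective : Injective _≡_ _≡_ φ
  φ-injective = split-injective F ∘ ιA-injective ∘ join₃-injective n s t

  ψ-injective : Injective _≡_ _≡_ ψ
  ψ-injective = split-injective S ∘ ιD-injective ∘ join₃-injective n s t

  A-induced : IsInducedSubgraphVia A glued φ
  A-induced a b = sym (begin
    adj glued (φ a) (φ b)                      ≡⟨ glued-join₃ (ιA (split F a)) (ιA (split F b)) ⟩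
    adjE (ιA (split F a)) (ιA (split F b))     ≡⟨ adjE-ιA (split F a) (split F b) ⟩
    adjA (split F a) (split F b)               ≡⟨ cong₂ (adj A) (unsplit-split F a) (unsplit-split F b) ⟩
    adj A a b                                  ∎)
    where open ≡-Reasoning

  D-induced : IsInducedSubgraphVia D glued ψ
  D-induced a b = sym (begin
    adj glued (ψ a) (ψ b)                      ≡⟨ glued-join₃ (ιD (split S a)) (ιD (split S b)) ⟩
    adjE (ιD (split S a)) (ιD (split S b))     ≡⟨ adjE-ιD A≡D (split S a) (split S b) ⟩
    adjD (split S a) (split S b)               ≡⟨ cong₂ (adj D) (unsplit-split S a) (unsplit-split S b) ⟩
    adj D a b                                  ∎)
    where open ≡-Reasoning

  φf≗ψg : ∀ x → φ (f x) ≡ ψ (g x)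
  φf≗ψg x =
    trans (cong (join₃ n s t ∘ ιA) (split-f F x)) (sym (cong (join₃ n s t ∘ ιD) (split-f S x)))

lemma3p1 : ∀ {n : ℕ} (s t : ℕ) (G₁ G₂ G₃ : Graph n) →
    IsPerturbation s G₂ G₁ → IsPerturbation t G₃ G₂ → IsPerturbation (s + t) G₃ G₁
lemma3p1 s t G₁ G₂ G₃ (H₁ , f , f-inj , (A , H₁~A , G₂⊴A) , G₁⊑H₁)
                      (H₂ , g , g-inj , G₃⊑H₂ , (D , H₂~D , G₂⊴D)) =
  graph , φ ∘ f , f-inj ∘ φ-injective , G₃⊑K , G₁⊑K
  where
  amalgam : Amalgam A D f g
  amalgam = amalgamate {G = G₂} f-inj g-inj G₂⊴A G₂⊴D
  open Amalgam amalgam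

  H₁⊑K : IsVertexMinorVia H₁ graph φ
  H₁⊑K = liftLocalEquivalence⁻¹ {H = graph} φ-injective A-induced H₁~A

  H₂⊑K : IsVertexMinorVia H₂ graph ψ
  H₂⊑K = liftLocalEquivalence⁻¹ {H = graph} ψ-injective D-induced H₂~D

  G₁⊑K : IsVertexMinorVia G₁ graph (φ ∘ f)
  G₁⊑K = vertexMinor-trans {G = G₁} {H = H₁} {f = f} {g = φ} φ-injective G₁⊑H₁ H₁⊑K

  G₃⊑K-via-ψ : IsVertexMinorVia G₃ graph (ψ ∘ g)
  G₃⊑K-via-ψ = vertexMinor-trans {G = G₃} {H = H₂} {f = g} {g = ψ} ψ-injective G₃⊑H₂ H₂⊑K

  G₃⊑K : IsVertexMinorVia G₃ graph (φ ∘ f)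
  G₃⊑K = vertexMinor-cong {G = G₃} {f = ψ ∘ g} (sym ∘ φf≗ψg) G₃⊑K-via-ψ
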